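{- Fix positive integers $m$ and $t$. Then the sequences $(T(m,n,t))_{n\ge0}$ and $(T(m,n,1)^t)_{n\ge0}$ each satisfy a linear homogeneous recurrence relation with constant coefficients.
   Context: The grid graph $\mathcal{G}(m,n)$ has vertex set $\{(i,j)\in\mathbf{Z}^2: 0\le i<n,\ 0\le j<m\}$, with $(i,j),(i',j')$ adjacent iff $|i-i'|+|j-j'|=1$. A magic labelling of sum $t$ of a graph $G$ is a function $E(G)\to\mathbf{Z}_{\ge0}$ such that for each vertex the labels of the incident edges sum to $t$. $T(m,n,t)$ denotes the number of magic labellings of sum $t$ of $\mathcal{G}(m,n)$; in particular $T(m,n,1)$ is the number of perfect matchings of $\mathcal{G}(m,n)$, i.e. the number of domino tilings of an $m\times n$ board, and $T(m,n,1)^t$ counts domino stackings of height $t$ (ordered $t$-tuples of tilings). -}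

module Defs where

open import Data.Nat using (ℕ; zero; suc; _+_; _∸_; _<_; _≟_)
open import Data.Integer as ℤ using (ℤ; +_)
open import Data.Fin using (Fin; toℕ)
import Data.Fin as Fin
open import Data.Vec using (Vec; []; _∷_)
import Data.Vec as Vec
open import Data.List using (List; []; _∷_; upTo; map; concatMap; filter; length; zip)
open import Data.Nat.ListAction using (sum)
open import Data.List.Relation.Unary.All using (All; all?)
open import Data.Sum using (_⊎_)
open import Data.Product using (_×_; _,_; proj₁; proj₂)
open import Data.Product.Properties using (≡-dec)
open import Relation.Binary.PropositionalEquality using (_≡_)
open import Relation.Nullary using (Dec; yes; no)
open import Relation.Nullary.Decidable using (_⊎-dec_)

Vertex : Set
Vertex = ℕ × ℕ

Edge : Set
Edge = Vertex × Vertex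

vertices : ℕ → ℕ → List Vertex
vertices m n = concatMap (λ i → map (λ j → (i , j)) (upTo m)) (upTo n)

hEdges : ℕ → ℕ → List Edge
hEdges m n = concatMap (λ i → map (λ j → ((i , j) , (suc i , j))) (upTo m)) (upTo (n ∸ 1))

vEdges : ℕ → ℕ → List Edge
vEdges m n = concatMap (λ i → map (λ j → ((i , j) , (i , suc j))) (upTo (m ∸ 1))) (upTo n)

edges : ℕ → ℕ → List Edge
edges m n = hEdges m n Data.List.++ vEdges m n

-- Labellings: a label (natural number) for each edge, in the order of 'edges m n'.

Labelling : ℕ → ℕ → Set
Labelling m n = Vec ℕ (length (edges m n))

_≟V_ : (u v : Vertex) → Dec (u ≡ v)
_≟V_ = ≡-dec _≟_ _≟_

incident? : (v : Vertex) (e : Edge) → Dec ((proj₁ e ≡ v) ⊎ (proj₂ e ≡ v))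
incident? v e = (proj₁ e ≟V v) ⊎-dec (proj₂ e ≟V v)

vertexSum : (m n : ℕ) → Labelling m n → Vertex → ℕ
vertexSum m n ℓ v = sum (map proj₂ (filter (λ p → incident? v (proj₁ p)) (zip (edges m n) (Vec.toList ℓ))))

IsMagic : (m n t : ℕ) → Labelling m n → Set
IsMagic m n t ℓ = All (λ v → vertexSum m n ℓ v ≡ t) (vertices m n)

isMagic? : (m n t : ℕ) (ℓ : Labelling m n) → Dec (IsMagic m n t ℓ)
isMagic? m n t ℓ = all? (λ v → vertexSum m n ℓ v ≟ t) (vertices m n)

boundedVecs : (k b : ℕ) → List (Vec ℕ k)
boundedVecs zero    b = [] ∷ []
boundedVecs (suc k) b = concatMap (λ x → map (x ∷_) (boundedVecs k b)) (upTo (suc b))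

-- T(m,n,t): number of magic labellings of sum t of G(m,n).
-- (Every label of a magic labelling of sum t is ≤ t, since each edge has an
-- endpoint; so enumerating labels in {0,…,t} counts all of them.)
T : ℕ → ℕ → ℕ → ℕ
T m n t = length (filter (isMagic? m n t) (boundedVecs (length (edges m n)) t))

ΣFin : (k : ℕ) → (Fin k → ℤ) → ℤ
ΣFin zero    f = + 0
ΣFin (suc k) f = f Fin.zero ℤ.+ ΣFin k (λ i → f (Fin.suc i))

-- a satisfies a(n+k) = c₁ a(n+k-1) + … + c_k a(n) for all n ≥ 0,
-- for some order k and constants c₁,…,c_k (c (i) stands for c_{i+1}).
SatisfiesLinearRecurrence : (ℕ → ℤ) → Set
SatisfiesLinearRecurrence a =
  Data.Product.Σ ℕ λ k → Data.Product.Σ (Fin k → ℤ) λ c →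
    ∀ n → a (n + k) ≡ ΣFin k (λ i → c i ℤ.* a (n + k ∸ suc (toℕ i)))

-- Cut G(m, n + 1) before its last column: let C n y count the magic labellings of G(m, n + 1)
-- extended by the m edges leading to a new column, these edges carrying the labels y ∈ {0,…,t}ᵐ.
-- Splitting off the last column gives C (n + 1) y = ∑_z K z y · C n z for a transfer matrix K
-- independent of n, and T(m, n + 1, t) = C n 0. So n ↦ T(m, n, t) is a fixed linear functional of
-- the iterates of a finite integer matrix (one extra state supplies n = 0), and sequences of this
-- kind are closed under products by tensoring, which covers T(m, n, 1)ᵗ. Every such sequence
-- satisfies a recurrence: eliminating the states one at a time, each time treating the eliminated
-- state's contribution as an inhomogeneity, yields a monic shift operator annihilating every
-- coordinate (a constructive substitute for the Cayley–Hamilton theorem).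

module Submission where

open import Defs
open import Data.Nat as ℕ using (ℕ; zero; suc; _∸_; _≤_; _<_; _^_; z≤n; s≤s)
import Data.Nat.Properties as ℕ
open import Data.Nat.ListAction using (sum)
open import Data.Nat.ListAction.Properties using (sum-++)
import Data.Nat.Tactic.RingSolver as ℕ-Solver
open import Data.Integer using (ℤ; +_; 0ℤ; 1ℤ; -1ℤ; _+_; _*_; -_) renaming (_^_ to _^ℤ_)
import Data.Integer.Properties as ℤ
open import Data.Integer.Tactic.RingSolver using (solve-∀)
open import Data.Bool using (Bool; true; false; if_then_else_)
open import Data.Fin as Fin using (Fin; toℕ)
import Data.Fin.Properties as Fin
open import Data.List using (List; []; _∷_; _++_; map; concatMap; cartesianProduct; filter; length; zip; upTo; replicate)
import Data.List.Properties as List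
open import Data.List.Relation.Unary.All as All using (All; []; _∷_; all?)
import Data.List.Relation.Unary.All.Properties as All
open import Data.Vec as Vec using (toList)
import Data.Vec.Properties as Vec
open import Data.Maybe using (Maybe; nothing; just)
open import Data.Product using (_×_; _,_; proj₁; proj₂)
open import Data.Sum using (_⊎_; inj₁; inj₂)
open import Data.Unit using (⊤; tt)
open import Function using (_∘_; id)
open import Relation.Nullary using (Dec; yes; no; does; ¬_; contradiction)
open import Relation.Binary.PropositionalEquality
open ≡-Reasoning

private variable
  A B C D S : Set

∑ : List A → (A → ℤ) → ℤ
∑ []       f = 0ℤ
∑ (x ∷ xs) f = f x + ∑ xs f

Π : List A → (A → ℤ) → ℤ
Π []       f = 1ℤ
Π (x ∷ xs) f = f x * Π xs f

∑-cong : (xs : List A) {f g : A → ℤ} → (∀ x → f x ≡ g x) → ∑ xs f ≡ ∑ xs g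
∑-cong []       f≗g = refl
∑-cong (x ∷ xs) f≗g = cong₂ _+_ (f≗g x) (∑-cong xs f≗g)

∑-zero : (xs : List A) → ∑ xs (λ _ → 0ℤ) ≡ 0ℤ
∑-zero []       = refl
∑-zero (x ∷ xs) = trans (ℤ.+-identityˡ _) (∑-zero xs)

∑-distrib-+ : (xs : List A) (f g : A → ℤ) → ∑ xs (λ x → f x + g x) ≡ ∑ xs f + ∑ xs g
∑-distrib-+ []       f g = refl
∑-distrib-+ (x ∷ xs) f g = begin
  f x + g x + ∑ xs (λ x → f x + g x) ≡⟨ cong (_+_ (f x + g x)) (∑-distrib-+ xs f g) ⟩
  f x + g x + (∑ xs f + ∑ xs g)      ≡⟨ lemma (f x) (g x) (∑ xs f) (∑ xs g) ⟩
  f x + ∑ xs f + (g x + ∑ xs g)      ∎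
  where lemma : ∀ a b c d → a + b + (c + d) ≡ a + c + (b + d)
        lemma = solve-∀

∑-*ˡ : (xs : List A) (c : ℤ) (f : A → ℤ) → ∑ xs (λ x → c * f x) ≡ c * ∑ xs f
∑-*ˡ []       c f = sym (ℤ.*-zeroʳ c)
∑-*ˡ (x ∷ xs) c f = trans (cong (_+_ (c * f x)) (∑-*ˡ xs c f)) (sym (ℤ.*-distribˡ-+ c (f x) (∑ xs f)))

∑-*ʳ : (xs : List A) (c : ℤ) (f : A → ℤ) → ∑ xs (λ x → f x * c) ≡ ∑ xs f * c
∑-*ʳ xs c f = begin
  ∑ xs (λ x → f x * c) ≡⟨ ∑-cong xs (λ x → ℤ.*-comm (f x) c) ⟩
  ∑ xs (λ x → c * f x) ≡⟨ ∑-*ˡ xs c f ⟩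
  c * ∑ xs f           ≡⟨ ℤ.*-comm c (∑ xs f) ⟩
  ∑ xs f * c           ∎

∑-neg : (xs : List A) (f : A → ℤ) → ∑ xs (λ x → - f x) ≡ - ∑ xs f
∑-neg []       f = refl
∑-neg (x ∷ xs) f = trans (cong (_+_ (- f x)) (∑-neg xs f)) (sym (ℤ.neg-distrib-+ (f x) (∑ xs f)))

∑-++ : (xs ys : List A) (f : A → ℤ) → ∑ (xs ++ ys) f ≡ ∑ xs f + ∑ ys f
∑-++ []       ys f = sym (ℤ.+-identityˡ (∑ ys f))
∑-++ (x ∷ xs) ys f = trans (cong (_+_ (f x)) (∑-++ xs ys f)) (sym (ℤ.+-assoc (f x) (∑ xs f) (∑ ys f)))

∑-map : (g : B → A) (xs : List B) (f : A → ℤ) → ∑ (map g xs) f ≡ ∑ xs (λ x → f (g x))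
∑-map g []       f = refl
∑-map g (x ∷ xs) f = cong (_+_ (f (g x))) (∑-map g xs f)

∑-concatMap : (g : B → List A) (xs : List B) (f : A → ℤ) →
              ∑ (concatMap g xs) f ≡ ∑ xs (λ x → ∑ (g x) f)
∑-concatMap g []       f = refl
∑-concatMap g (x ∷ xs) f = trans (∑-++ (g x) (concatMap g xs) f) (cong (_+_ (∑ (g x) f)) (∑-concatMap g xs f))

∑-comm : (xs : List A) (ys : List B) (f : A → B → ℤ) →
         ∑ xs (λ x → ∑ ys (λ y → f x y)) ≡ ∑ ys (λ y → ∑ xs (λ x → f x y))
∑-comm []       ys f = sym (∑-zero ys)
∑-comm (x ∷ xs) ys f = trans (cong (_+_ (∑ ys (f x))) (∑-comm xs ys f))
                             (sym (∑-distrib-+ ys (f x) (λ y → ∑ xs (λ x → f x y))))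

∑-*-∑ : (xs : List A) (ys : List B) (f : A → ℤ) (g : B → ℤ) →
        ∑ xs (λ x → ∑ ys (λ y → f x * g y)) ≡ ∑ xs f * ∑ ys g
∑-*-∑ xs ys f g = trans (∑-cong xs (λ x → ∑-*ˡ ys (f x) g)) (∑-*ʳ xs (∑ ys g) f)

∑-regroup : (as : List A) (bs : List B) (cs : List C) (ds : List D) (f : A → B → C → ℤ) (g : B → D → ℤ) →
            ∑ as (λ a → ∑ bs (λ b → ∑ cs (λ c → ∑ ds (λ d → f a b c * g b d)))) ≡
            ∑ bs (λ b → ∑ as (λ a → ∑ cs (f a b)) * ∑ ds (g b))
∑-regroup as bs cs ds f g = begin
  ∑ as (λ a → ∑ bs (λ b → ∑ cs (λ c → ∑ ds (λ d → f a b c * g b d))))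
    ≡⟨ ∑-cong as (λ a → ∑-cong bs (λ b → ∑-*-∑ cs ds (f a b) (g b))) ⟩
  ∑ as (λ a → ∑ bs (λ b → ∑ cs (f a b) * ∑ ds (g b)))
    ≡⟨ ∑-comm as bs (λ a b → ∑ cs (f a b) * ∑ ds (g b)) ⟩
  ∑ bs (λ b → ∑ as (λ a → ∑ cs (f a b) * ∑ ds (g b)))
    ≡⟨ ∑-cong bs (λ b → ∑-*ʳ as (∑ ds (g b)) (λ a → ∑ cs (f a b))) ⟩
  ∑ bs (λ b → ∑ as (λ a → ∑ cs (f a b)) * ∑ ds (g b)) ∎

∑-cartesianProduct : (xs : List A) (ys : List B) (f : A → ℤ) (g : B → ℤ) →
                     ∑ (cartesianProduct xs ys) (λ (x , y) → f x * g y) ≡ ∑ xs f * ∑ ys g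
∑-cartesianProduct []       ys f g = refl
∑-cartesianProduct (x ∷ xs) ys f g = begin
  ∑ (map (x ,_) ys ++ cartesianProduct xs ys) h  ≡⟨ ∑-++ (map (x ,_) ys) _ h ⟩
  ∑ (map (x ,_) ys) h + ∑ (cartesianProduct xs ys) h
    ≡⟨ cong₂ _+_ (trans (∑-map (x ,_) ys h) (∑-*ˡ ys (f x) g)) (∑-cartesianProduct xs ys f g) ⟩
  f x * ∑ ys g + ∑ xs f * ∑ ys g                 ≡⟨ ℤ.*-distribʳ-+ (∑ ys g) (f x) (∑ xs f) ⟨
  (f x + ∑ xs f) * ∑ ys g                        ∎
  where h = λ (x , y) → f x * g y

Π-cong : {xs : List A} {f g : A → ℤ} → All (λ x → f x ≡ g x) xs → Π xs f ≡ Π xs g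
Π-cong []           = refl
Π-cong (fx≡gx ∷ eqs) = cong₂ _*_ fx≡gx (Π-cong eqs)

Π-++ : (xs ys : List A) (f : A → ℤ) → Π (xs ++ ys) f ≡ Π xs f * Π ys f
Π-++ []       ys f = sym (ℤ.*-identityˡ (Π ys f))
Π-++ (x ∷ xs) ys f = trans (cong (f x *_) (Π-++ xs ys f)) (sym (ℤ.*-assoc (f x) (Π xs f) (Π ys f)))

Π-map : (g : B → A) (xs : List B) (f : A → ℤ) → Π (map g xs) f ≡ Π xs (λ x → f (g x))
Π-map g []       f = refl
Π-map g (x ∷ xs) f = cong (f (g x) *_) (Π-map g xs f)

zip-++ : (xs₁ xs₂ : List A) (ys₁ ys₂ : List C) → length xs₁ ≡ length ys₁ →
         zip (xs₁ ++ xs₂) (ys₁ ++ ys₂) ≡ zip xs₁ ys₁ ++ zip xs₂ ys₂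
zip-++ []         xs₂ []         ys₂ _  = refl
zip-++ (x ∷ xs₁) xs₂ (y ∷ ys₁) ys₂ eq = cong ((x , y) ∷_) (zip-++ xs₁ xs₂ ys₁ ys₂ (ℕ.suc-injective eq))

concatMap-upTo-suc : (f : ℕ → List A) (n : ℕ) → concatMap f (upTo (suc n)) ≡ concatMap f (upTo n) ++ f n
concatMap-upTo-suc f n = begin
  concatMap f (upTo (suc n))          ≡⟨ cong (concatMap f) (List.upTo-∷ʳ n) ⟨
  concatMap f (upTo n ++ n ∷ [])      ≡⟨ List.concatMap-++ f (upTo n) (n ∷ []) ⟩
  concatMap f (upTo n) ++ f n ++ []   ≡⟨ cong (concatMap f (upTo n) ++_) (List.++-identityʳ (f n)) ⟩
  concatMap f (upTo n) ++ f n         ∎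

All-upTo : ∀ n {P : ℕ → Set} → (∀ i → i < n → P i) → All P (upTo n)
All-upTo n P<n = All.applyUpTo⁺₁ id n (λ {i} → P<n i)

All-map-upTo : ∀ n {P : A → Set} (f : ℕ → A) → (∀ j → j < n → P (f j)) → All P (map f (upTo n))
All-map-upTo n f P<n = All.map⁺ (All-upTo n P<n)

All-concatMap-upTo : ∀ n {P : A → Set} (f : ℕ → List A) → (∀ i → i < n → All P (f i)) → All P (concatMap f (upTo n))
All-concatMap-upTo n f P<n = All.concat⁺ (All.map⁺ (All-upTo n P<n))

All-concatMap⁺ : {P : B → Set} {f : A → List B} (xs : List A) → (∀ x → All P (f x)) → All P (concatMap f xs)
All-concatMap⁺ xs all-f = All.concat⁺ (All.map⁺ {xs = xs} (All.tabulate (λ {x} _ → all-f x)))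

-- A combination ∑ c · u s (n + i) of shifts of a family of sequences u indexed by S; an
-- operator ∑ c · Sⁱ in the shift S is a combination over the one-member family.
Combination : Set → Set
Combination S = List (ℤ × ℕ × S)

⟦_⟧ : Combination S → (S → ℕ → ℤ) → ℕ → ℤ
⟦ M ⟧ u n = ∑ M (λ (c , i , s) → c * u s (n ℕ.+ i))

Operator : Set
Operator = Combination ⊤

⟦_⟧ₒ : Operator → (ℕ → ℤ) → ℕ → ℤ
⟦ P ⟧ₒ f = ⟦ P ⟧ (λ _ → f)

monic : ℕ → Operator → Operator
monic d L = (1ℤ , d , tt) ∷ L

scaleShift : ℤ × ℕ → Combination S → Combination S
scaleShift (c , i) M = map (λ (d , j , s) → (c * d , i ℕ.+ j , s)) M

_⊛_ : Operator → Combination S → Combination S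
P ⊛ M = concatMap (λ (c , i , _) → scaleShift (c , i) M) P

Degree< : ℕ → Combination S → Set
Degree< d M = All (λ (_ , i , _) → i < d) M

Degree≤ : ℕ → Combination S → Set
Degree≤ d M = All (λ (_ , i , _) → i ≤ d) M

⟦⟧-cong : (M : Combination S) {u v : S → ℕ → ℤ} → (∀ s n → u s n ≡ v s n) → ∀ n → ⟦ M ⟧ u n ≡ ⟦ M ⟧ v n
⟦⟧-cong M u≗v n = ∑-cong M (λ (c , i , s) → cong (c *_) (u≗v s (n ℕ.+ i)))

⟦⟧-zero : (M : Combination S) → ∀ n → ⟦ M ⟧ (λ _ _ → 0ℤ) n ≡ 0ℤ
⟦⟧-zero M n = trans (∑-cong M (λ (c , _ , _) → ℤ.*-zeroʳ c)) (∑-zero M)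

⟦⟧-+ : (M : Combination S) (u v : S → ℕ → ℤ) → ∀ n →
       ⟦ M ⟧ (λ s m → u s m + v s m) n ≡ ⟦ M ⟧ u n + ⟦ M ⟧ v n
⟦⟧-+ M u v n = trans (∑-cong M (λ (c , _ , _) → ℤ.*-distribˡ-+ c _ _)) (∑-distrib-+ M _ _)

⟦⟧ₒ-* : (P : Operator) (c : ℤ) (f : ℕ → ℤ) → ∀ n → ⟦ P ⟧ₒ (λ m → c * f m) n ≡ c * ⟦ P ⟧ₒ f n
⟦⟧ₒ-* P c f n = trans (∑-cong P (λ (d , i , _) → lemma d c (f (n ℕ.+ i)))) (∑-*ˡ P c _)
  where lemma : ∀ a b x → a * (b * x) ≡ b * (a * x)
        lemma = solve-∀

⟦⟧-∑ : (M : Combination S) (xs : List A) (F : A → S → ℕ → ℤ) → ∀ n →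
       ⟦ M ⟧ (λ s m → ∑ xs (λ x → F x s m)) n ≡ ∑ xs (λ x → ⟦ M ⟧ (F x) n)
⟦⟧-∑ M xs F n = trans (∑-cong M (λ (c , _ , _) → sym (∑-*ˡ xs c _))) (∑-comm M xs _)

⟦⟧-shift : (M : Combination S) (u : S → ℕ → ℤ) (j : ℕ) → ∀ n →
           ⟦ M ⟧ (λ s m → u s (m ℕ.+ j)) n ≡ ⟦ M ⟧ u (n ℕ.+ j)
⟦⟧-shift M u j n = ∑-cong M (λ (c , i , s) → cong (λ k → c * u s k) (swap-last n i j))
  where swap-last : ∀ a b c → a ℕ.+ b ℕ.+ c ≡ a ℕ.+ c ℕ.+ b
        swap-last = ℕ-Solver.solve-∀

⟦⟧-++ : (M K : Combination S) (u : S → ℕ → ℤ) → ∀ n → ⟦ M ++ K ⟧ u n ≡ ⟦ M ⟧ u n + ⟦ K ⟧ u n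
⟦⟧-++ M K u n = ∑-++ M K _

⟦scaleShift⟧ : (c : ℤ) (i : ℕ) (M : Combination S) (u : S → ℕ → ℤ) → ∀ n →
               ⟦ scaleShift (c , i) M ⟧ u n ≡ c * ⟦ M ⟧ u (n ℕ.+ i)
⟦scaleShift⟧ c i M u n = begin
  ⟦ scaleShift (c , i) M ⟧ u n                        ≡⟨ ∑-map _ M _ ⟩
  ∑ M (λ (d , j , s) → c * d * u s (n ℕ.+ (i ℕ.+ j)))   ≡⟨ ∑-cong M (λ (d , j , s) →
                                                          trans (ℤ.*-assoc c d _) (cong (λ k → c * (d * u s k)) (sym (ℕ.+-assoc n i j)))) ⟩
  ∑ M (λ (d , j , s) → c * (d * u s (n ℕ.+ i ℕ.+ j)))  ≡⟨ ∑-*ˡ M c _ ⟩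
  c * ⟦ M ⟧ u (n ℕ.+ i)                               ∎

⟦scale⟧ : (c : ℤ) (M : Combination S) (u : S → ℕ → ℤ) → ∀ n → ⟦ scaleShift (c , 0) M ⟧ u n ≡ c * ⟦ M ⟧ u n
⟦scale⟧ c M u n = trans (⟦scaleShift⟧ c 0 M u n) (cong (λ k → c * ⟦ M ⟧ u k) (ℕ.+-identityʳ n))

⟦⊛⟧ : (P : Operator) (M : Combination S) (u : S → ℕ → ℤ) → ∀ n → ⟦ P ⊛ M ⟧ u n ≡ ⟦ P ⟧ₒ (⟦ M ⟧ u) n
⟦⊛⟧ P M u n = trans (∑-concatMap _ P _) (∑-cong P (λ (c , i , _) → ⟦scaleShift⟧ c i M u n))

⟦⟧ₒ-⟦⟧-comm : (P : Operator) (M : Combination S) (u : S → ℕ → ℤ) → ∀ n →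
         ⟦ P ⟧ₒ (⟦ M ⟧ u) n ≡ ⟦ M ⟧ (λ s → ⟦ P ⟧ₒ (u s)) n
⟦⟧ₒ-⟦⟧-comm P M u n = begin
  ⟦ P ⟧ₒ (⟦ M ⟧ u) n                                        ≡⟨ ⟦⟧-∑ P M (λ (c , i , s) _ m → c * u s (m ℕ.+ i)) n ⟩
  ∑ M (λ (c , i , s) → ⟦ P ⟧ₒ (λ m → c * u s (m ℕ.+ i)) n)  ≡⟨ ∑-cong M (λ (c , i , s) →
                                                              trans (⟦⟧ₒ-* P c (λ m → u s (m ℕ.+ i)) n) (cong (c *_) (⟦⟧-shift P (λ _ → u s) i n))) ⟩
  ⟦ M ⟧ (λ s → ⟦ P ⟧ₒ (u s)) n                               ∎

scaleShift-degree< : ∀ {d} c i (M : Combination S) → Degree< d M → Degree< (i ℕ.+ d) (scaleShift (c , i) M)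
scaleShift-degree< c i M bound = All.map⁺ (All.map (ℕ.+-monoʳ-< i) bound)

⊛-degree≤< : ∀ {a b} (P : Operator) (M : Combination S) → Degree≤ a P → Degree< b M → Degree< (a ℕ.+ b) (P ⊛ M)
⊛-degree≤< []      M []           boundM = []
⊛-degree≤< (_ ∷ P) M (i≤a ∷ boundP) boundM =
  All.++⁺ (All.map⁺ (All.map (ℕ.+-mono-≤-< i≤a) boundM)) (⊛-degree≤< P M boundP boundM)

⊛-degree<≤ : ∀ {a b} (P : Operator) (M : Combination S) → Degree< a P → Degree≤ b M → Degree< (a ℕ.+ b) (P ⊛ M)
⊛-degree<≤ []      M []           boundM = []
⊛-degree<≤ (_ ∷ P) M (i<a ∷ boundP) boundM =
  All.++⁺ (All.map⁺ (All.map (ℕ.+-mono-<-≤ i<a) boundM)) (⊛-degree<≤ P M boundP boundM)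

monic-degree≤ : ∀ {d} (L : Operator) → Degree< d L → Degree≤ d (monic d L)
monic-degree≤ L bound = ℕ.≤-refl ∷ All.map ℕ.<⇒≤ bound

IsLinearSystem : (S → S → ℤ) → List S → (x u : S → ℕ → ℤ) → Set
IsLinearSystem A ss x u = ∀ s n → x s (suc n) ≡ ∑ ss (λ r → A s r * x r n) + u s n

record AnnihilatorModulo {S : Set} (x u : S → ℕ → ℤ) : Set where
  field
    degree         : ℕ
    lower          : Operator
    lower-degree   : Degree< degree lower
    residue        : S → Combination S
    residue-degree : ∀ s → Degree< degree (residue s)
    annihilates    : ∀ s n → ⟦ monic degree lower ⟧ₒ (x s) n ≡ ⟦ residue s ⟧ u n

annihilator-uncoupled : (A : S → S → ℤ) (x u : S → ℕ → ℤ) → IsLinearSystem A [] x u → AnnihilatorModulo x u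
annihilator-uncoupled A x u system = record
  { degree = 1 ; lower = [] ; lower-degree = []
  ; residue = λ s → (1ℤ , 0 , s) ∷ [] ; residue-degree = λ _ → s≤s z≤n ∷ []
  ; annihilates = λ s n → begin
      1ℤ * x s (n ℕ.+ 1) + 0ℤ ≡⟨ cong (λ k → 1ℤ * x s k + 0ℤ) (ℕ.+-comm n 1) ⟩
      1ℤ * x s (suc n) + 0ℤ   ≡⟨ cong (λ z → 1ℤ * z + 0ℤ) (trans (system s n) (ℤ.+-identityˡ (u s n))) ⟩
      1ℤ * u s n + 0ℤ         ≡⟨ cong (λ k → 1ℤ * u s k + 0ℤ) (ℕ.+-identityʳ n) ⟨
      1ℤ * u s (n ℕ.+ 0) + 0ℤ ∎ }

at : S → Operator → Combination S
at r P = map (λ (c , i , _) → (c , i , r)) P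

⟦at⟧ : (r : S) (P : Operator) (u : S → ℕ → ℤ) → ∀ n → ⟦ at r P ⟧ u n ≡ ⟦ P ⟧ₒ (u r) n
⟦at⟧ r P u n = ∑-map _ P _

-- Induction step: the state r₀ is eliminated from the system on r₀ ∷ ss by treating its
-- contribution A s r₀ * x r₀ as an inhomogeneity, then annihilating x r₀ itself.
module EliminationStep (A : S → S → ℤ) (r₀ : S) (ss : List S) (x u : S → ℕ → ℤ)
                       (system : IsLinearSystem A (r₀ ∷ ss) x u) where

  u′ : S → ℕ → ℤ
  u′ s n = A s r₀ * x r₀ n + u s n

  system′ : IsLinearSystem A ss x u′
  system′ s n = trans (system s n) (lemma (A s r₀ * x r₀ n) (∑ ss (λ r → A s r * x r n)) (u s n))
    where lemma : ∀ a b c → a + b + c ≡ b + (a + c)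
          lemma = solve-∀

  x₀ : ℕ → ℤ
  x₀ = x r₀

  onX₀ : Combination S → Operator
  onX₀ K = map (λ (c , i , s) → (c * A s r₀ , i , tt)) K

  ⟦⟧-u′ : (K : Combination S) → ∀ n → ⟦ K ⟧ u′ n ≡ ⟦ K ⟧ u n + ⟦ onX₀ K ⟧ₒ x₀ n
  ⟦⟧-u′ K n = begin
    ⟦ K ⟧ u′ n                                          ≡⟨ ⟦⟧-+ K (λ s m → A s r₀ * x₀ m) u n ⟩
    ⟦ K ⟧ (λ s m → A s r₀ * x₀ m) n + ⟦ K ⟧ u n         ≡⟨ ℤ.+-comm _ (⟦ K ⟧ u n) ⟩
    ⟦ K ⟧ u n + ⟦ K ⟧ (λ s m → A s r₀ * x₀ m) n         ≡⟨ cong (_+_ (⟦ K ⟧ u n)) (sym (trans (∑-map _ K _)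
                                                           (∑-cong K (λ (c , i , s) → ℤ.*-assoc c (A s r₀) _)))) ⟩
    ⟦ K ⟧ u n + ⟦ onX₀ K ⟧ₒ x₀ n                        ∎

  module _ (IH : AnnihilatorModulo x u′) where
    open AnnihilatorModulo IH renaming
      (degree to d; lower to L; lower-degree to L-degree; residue to M; residue-degree to M-degree; annihilates to P-x)

    P : Operator
    P = monic d L

    P-degree : Degree< (suc d) P
    P-degree = All.map s≤s (monic-degree≤ L L-degree)

    onX₀-degree : ∀ {e} (K : Combination S) → Degree< e K → Degree< e (onX₀ K)
    onX₀-degree K bound = All.map⁺ bound

    -- Q = (S - A r₀ r₀) P - ∑ A r₀ r · onX₀ (M r) annihilates x₀ modulo u.
    Q-tail : Operator
    Q-tail = scaleShift (- A r₀ r₀ , 0) P ++ concatMap (λ r → scaleShift (- A r₀ r , 0) (onX₀ (M r))) ss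

    Q-lower : Operator
    Q-lower = scaleShift (1ℤ , 1) L ++ Q-tail

    Q : Operator
    Q = monic (suc d) Q-lower

    Q-lower-degree : Degree< (suc d) Q-lower
    Q-lower-degree = All.++⁺ (scaleShift-degree< 1ℤ 1 L L-degree)
      (All.++⁺ (scaleShift-degree< (- A r₀ r₀) 0 P P-degree)
               (All-concatMap⁺ ss (λ r → scaleShift-degree< (- A r₀ r) 0 (onX₀ (M r))
                                           (All.map ℕ.m<n⇒m<1+n (onX₀-degree (M r) (M-degree r))))))

    ⟦Q⟧ₒ : (f : ℕ → ℤ) → ∀ n →
           ⟦ Q ⟧ₒ f n ≡ ⟦ P ⟧ₒ f (suc n) + (- A r₀ r₀ * ⟦ P ⟧ₒ f n + - ∑ ss (λ r → A r₀ r * ⟦ onX₀ (M r) ⟧ₒ f n))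
    ⟦Q⟧ₒ f n = begin
      ⟦ scaleShift (1ℤ , 1) P ++ Q-tail ⟧ₒ f n
        ≡⟨ ⟦⟧-++ (scaleShift (1ℤ , 1) P) Q-tail (λ _ → f) n ⟩
      ⟦ scaleShift (1ℤ , 1) P ⟧ₒ f n + ⟦ Q-tail ⟧ₒ f n
        ≡⟨ cong₂ _+_ (trans (⟦scaleShift⟧ 1ℤ 1 P (λ _ → f) n) (trans (ℤ.*-identityˡ _) (cong (⟦ P ⟧ₒ f) (ℕ.+-comm n 1))))
                     (⟦⟧-++ (scaleShift (- A r₀ r₀ , 0) P) _ (λ _ → f) n) ⟩
      ⟦ P ⟧ₒ f (suc n) + (⟦ scaleShift (- A r₀ r₀ , 0) P ⟧ₒ f n + ⟦ concatMap (λ r → scaleShift (- A r₀ r , 0) (onX₀ (M r))) ss ⟧ₒ f n)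
        ≡⟨ cong (_+_ (⟦ P ⟧ₒ f (suc n))) (cong₂ _+_ (⟦scale⟧ (- A r₀ r₀) P (λ _ → f) n) (begin
             ⟦ concatMap (λ r → scaleShift (- A r₀ r , 0) (onX₀ (M r))) ss ⟧ₒ f n
               ≡⟨ ∑-concatMap _ ss _ ⟩
             ∑ ss (λ r → ⟦ scaleShift (- A r₀ r , 0) (onX₀ (M r)) ⟧ₒ f n)
               ≡⟨ ∑-cong ss (λ r → trans (⟦scale⟧ (- A r₀ r) (onX₀ (M r)) (λ _ → f) n) (sym (ℤ.neg-distribˡ-* (A r₀ r) _))) ⟩
             ∑ ss (λ r → - (A r₀ r * ⟦ onX₀ (M r) ⟧ₒ f n))
               ≡⟨ ∑-neg ss _ ⟩
             - ∑ ss (λ r → A r₀ r * ⟦ onX₀ (M r) ⟧ₒ f n) ∎)) ⟩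
      ⟦ P ⟧ₒ f (suc n) + (- A r₀ r₀ * ⟦ P ⟧ₒ f n + - ∑ ss (λ r → A r₀ r * ⟦ onX₀ (M r) ⟧ₒ f n)) ∎

    P-x₀-suc : ∀ n → ⟦ P ⟧ₒ x₀ (suc n) ≡ ∑ (r₀ ∷ ss) (λ r → A r₀ r * ⟦ P ⟧ₒ (x r) n) + ⟦ P ⟧ₒ (u r₀) n
    P-x₀-suc n = begin
      ⟦ P ⟧ₒ (λ m → x₀ (suc m)) n
        ≡⟨ ⟦⟧-cong P (λ _ → system r₀) n ⟩
      ⟦ P ⟧ₒ (λ m → ∑ (r₀ ∷ ss) (λ r → A r₀ r * x r m) + u r₀ m) n
        ≡⟨ ⟦⟧-+ P (λ _ m → ∑ (r₀ ∷ ss) (λ r → A r₀ r * x r m)) (λ _ → u r₀) n ⟩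
      ⟦ P ⟧ₒ (λ m → ∑ (r₀ ∷ ss) (λ r → A r₀ r * x r m)) n + ⟦ P ⟧ₒ (u r₀) n
        ≡⟨ cong (_+ ⟦ P ⟧ₒ (u r₀) n) (trans (⟦⟧-∑ P (r₀ ∷ ss) (λ r _ m → A r₀ r * x r m) n)
             (∑-cong (r₀ ∷ ss) (λ r → ⟦⟧ₒ-* P (A r₀ r) (x r) n))) ⟩
      ∑ (r₀ ∷ ss) (λ r → A r₀ r * ⟦ P ⟧ₒ (x r) n) + ⟦ P ⟧ₒ (u r₀) n ∎

    N : Combination S
    N = concatMap (λ r → scaleShift (A r₀ r , 0) (M r)) ss ++ at r₀ P

    N-degree : Degree< (suc d) N
    N-degree = All.++⁺ (All-concatMap⁺ ss (λ r →
                 scaleShift-degree< (A r₀ r) 0 (M r) (All.map ℕ.m<n⇒m<1+n (M-degree r))))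
               (All.map⁺ P-degree)

    ⟦N⟧ : ∀ n → ⟦ N ⟧ u n ≡ ∑ ss (λ r → A r₀ r * ⟦ M r ⟧ u n) + ⟦ P ⟧ₒ (u r₀) n
    ⟦N⟧ n = trans (⟦⟧-++ (concatMap (λ r → scaleShift (A r₀ r , 0) (M r)) ss) (at r₀ P) u n) (cong₂ _+_
      (trans (∑-concatMap (λ r → scaleShift (A r₀ r , 0) (M r)) ss _) (∑-cong ss (λ r → ⟦scale⟧ (A r₀ r) (M r) u n)))
      (⟦at⟧ r₀ P u n))

    Q-x₀ : ∀ n → ⟦ Q ⟧ₒ x₀ n ≡ ⟦ N ⟧ u n
    Q-x₀ n = begin
      ⟦ Q ⟧ₒ x₀ n
        ≡⟨ ⟦Q⟧ₒ x₀ n ⟩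
      ⟦ P ⟧ₒ x₀ (suc n) + (- A₀₀ * ⟦ P ⟧ₒ x₀ n + - Sₓ)
        ≡⟨ cong (_+ (- A₀₀ * ⟦ P ⟧ₒ x₀ n + - Sₓ)) (P-x₀-suc n) ⟩
      A₀₀ * ⟦ P ⟧ₒ x₀ n + ∑ ss (λ r → A r₀ r * ⟦ P ⟧ₒ (x r) n) + U + (- A₀₀ * ⟦ P ⟧ₒ x₀ n + - Sₓ)
        ≡⟨ cong (λ z → A₀₀ * ⟦ P ⟧ₒ x₀ n + z + U + (- A₀₀ * ⟦ P ⟧ₒ x₀ n + - Sₓ)) split ⟩
      A₀₀ * ⟦ P ⟧ₒ x₀ n + (Sᵤ + Sₓ) + U + (- A₀₀ * ⟦ P ⟧ₒ x₀ n + - Sₓ)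
        ≡⟨ cancel A₀₀ (⟦ P ⟧ₒ x₀ n) Sᵤ Sₓ U ⟩
      Sᵤ + U
        ≡⟨ ⟦N⟧ n ⟨
      ⟦ N ⟧ u n ∎
      where
      A₀₀ = A r₀ r₀
      U   = ⟦ P ⟧ₒ (u r₀) n
      Sᵤ  = ∑ ss (λ r → A r₀ r * ⟦ M r ⟧ u n)
      Sₓ  = ∑ ss (λ r → A r₀ r * ⟦ onX₀ (M r) ⟧ₒ x₀ n)
      split : ∑ ss (λ r → A r₀ r * ⟦ P ⟧ₒ (x r) n) ≡ Sᵤ + Sₓ
      split = trans (∑-cong ss (λ r → trans (cong (A r₀ r *_) (trans (P-x r n) (⟦⟧-u′ (M r) n)))
                                            (ℤ.*-distribˡ-+ (A r₀ r) _ _)))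
                    (∑-distrib-+ ss _ _)
      cancel : ∀ a y e f v → a * y + (e + f) + v + (- a * y + - f) ≡ e + v
      cancel = solve-∀

    -- The annihilator is Q ⊛ P, which computes to monic (suc d ℕ.+ d) (scaleShift (1ℤ , suc d) L ++ Q-lower ⊛ P).
    annihilator : AnnihilatorModulo x u
    annihilator = record
      { degree = suc d ℕ.+ d
      ; lower = scaleShift (1ℤ , suc d) L ++ Q-lower ⊛ P
      ; lower-degree = All.++⁺ (scaleShift-degree< 1ℤ (suc d) L L-degree)
                               (⊛-degree<≤ Q-lower P Q-lower-degree (monic-degree≤ L L-degree))
      ; residue = λ s → Q ⊛ M s ++ onX₀ (M s) ⊛ N
      ; residue-degree = λ s → All.++⁺ (⊛-degree≤< Q (M s) (monic-degree≤ Q-lower Q-lower-degree) (M-degree s))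
          (subst (λ e → Degree< e (onX₀ (M s) ⊛ N)) (ℕ.+-comm d (suc d))
                 (⊛-degree≤< (onX₀ (M s)) N (All.map ℕ.<⇒≤ (onX₀-degree (M s) (M-degree s))) N-degree))
      ; annihilates = λ s n → begin
          ⟦ Q ⊛ P ⟧ₒ (x s) n
            ≡⟨ ⟦⊛⟧ Q P (λ _ → x s) n ⟩
          ⟦ Q ⟧ₒ (⟦ P ⟧ₒ (x s)) n
            ≡⟨ ⟦⟧-cong Q (λ _ m → trans (P-x s m) (⟦⟧-u′ (M s) m)) n ⟩
          ⟦ Q ⟧ₒ (λ m → ⟦ M s ⟧ u m + ⟦ onX₀ (M s) ⟧ₒ x₀ m) n
            ≡⟨ ⟦⟧-+ Q (λ _ → ⟦ M s ⟧ u) (λ _ → ⟦ onX₀ (M s) ⟧ₒ x₀) n ⟩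
          ⟦ Q ⟧ₒ (⟦ M s ⟧ u) n + ⟦ Q ⟧ₒ (⟦ onX₀ (M s) ⟧ₒ x₀) n
            ≡⟨ cong₂ _+_ (sym (⟦⊛⟧ Q (M s) u n)) (⟦⟧ₒ-⟦⟧-comm Q (onX₀ (M s)) (λ _ → x₀) n) ⟩
          ⟦ Q ⊛ M s ⟧ u n + ⟦ onX₀ (M s) ⟧ₒ (⟦ Q ⟧ₒ x₀) n
            ≡⟨ cong (_+_ (⟦ Q ⊛ M s ⟧ u n)) (trans (⟦⟧-cong (onX₀ (M s)) (λ _ → Q-x₀) n) (sym (⟦⊛⟧ (onX₀ (M s)) N u n))) ⟩
          ⟦ Q ⊛ M s ⟧ u n + ⟦ onX₀ (M s) ⊛ N ⟧ u n
            ≡⟨ ⟦⟧-++ (Q ⊛ M s) _ u n ⟨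
          ⟦ Q ⊛ M s ++ onX₀ (M s) ⊛ N ⟧ u n ∎
      }

eliminate : (A : S → S → ℤ) (ss : List S) (x u : S → ℕ → ℤ) → IsLinearSystem A ss x u → AnnihilatorModulo x u
eliminate A []        x u system = annihilator-uncoupled A x u system
eliminate A (r₀ ∷ ss) x u system =
  annihilator (eliminate A ss x u′ system′)
  where open EliminationStep A r₀ ss x u system

single : ℕ → ℤ → ℕ → ℤ
single i c k with i ℕ.≟ k
... | yes _ = c
... | no  _ = 0ℤ

single-≡ : ∀ i c → single i c i ≡ c
single-≡ i c with i ℕ.≟ i
... | yes _   = refl
... | no  i≢i = contradiction refl i≢i

single-≢ : ∀ {i k} c → i ≢ k → single i c k ≡ 0ℤ
single-≢ {i} {k} c i≢k with i ℕ.≟ k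
... | yes i≡k = contradiction i≡k i≢k
... | no  _   = refl

coefficient : Operator → ℕ → ℤ
coefficient L k = ∑ L (λ (c , i , _) → single i c k)

-- The sum h (d - 1) + … + h 0, in the index order of SatisfiesLinearRecurrence.
ΣRev : (d : ℕ) → (ℕ → ℤ) → ℤ
ΣRev d h = ΣFin d (λ j → h (d ∸ suc (toℕ j)))

ΣFin-cong : ∀ d {f g : Fin d → ℤ} → (∀ j → f j ≡ g j) → ΣFin d f ≡ ΣFin d g
ΣFin-cong zero    f≗g = refl
ΣFin-cong (suc d) f≗g = cong₂ _+_ (f≗g Fin.zero) (ΣFin-cong d (λ j → f≗g (Fin.suc j)))

ΣRev-zero : ∀ d → ΣRev d (λ _ → 0ℤ) ≡ 0ℤ
ΣRev-zero zero    = refl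
ΣRev-zero (suc d) = trans (ℤ.+-identityˡ _) (ΣRev-zero d)

ΣRev-+ : ∀ d (f g : ℕ → ℤ) → ΣRev d (λ k → f k + g k) ≡ ΣRev d f + ΣRev d g
ΣRev-+ zero    f g = refl
ΣRev-+ (suc d) f g = trans (cong (_+_ (f d + g d)) (ΣRev-+ d f g)) (lemma (f d) (g d) (ΣRev d f) (ΣRev d g))
  where lemma : ∀ a b c e → a + b + (c + e) ≡ a + c + (b + e)
        lemma = solve-∀

ΣRev-single : ∀ d {i} → i < d → (c : ℤ) (g : ℕ → ℤ) → ΣRev d (λ k → single i c k * g k) ≡ c * g i
ΣRev-single (suc d) {i} i<1+d c g = by-cases (i ℕ.≟ d)
  where
  rev<d : (j : Fin d) → d ∸ suc (toℕ j) < d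
  rev<d j = ℕ.∸-monoʳ-< {o = 0} (s≤s z≤n) (Fin.toℕ<n j)

  by-cases : Dec (i ≡ d) → ΣRev (suc d) (λ k → single i c k * g k) ≡ c * g i
  by-cases (yes refl) = begin
    single d c d * g d + ΣRev d (λ k → single d c k * g k)
      ≡⟨ cong₂ _+_ (cong (_* g d) (single-≡ d c))
                   (trans (ΣFin-cong d (λ j → trans (cong (_* _) (single-≢ c (ℕ.>⇒≢ (rev<d j)))) (ℤ.*-zeroˡ (g (d ∸ suc (toℕ j))))))
                          (ΣRev-zero d)) ⟩
    c * g d + 0ℤ  ≡⟨ ℤ.+-identityʳ _ ⟩
    c * g d       ∎
  by-cases (no i≢d) = begin
    single i c d * g d + ΣRev d (λ k → single i c k * g k)
      ≡⟨ cong₂ _+_ (cong (_* g d) (single-≢ c i≢d)) (ΣRev-single d (ℕ.≤∧≢⇒< (ℕ.≤-pred i<1+d) i≢d) c g) ⟩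
    0ℤ * g d + c * g i ≡⟨ ℤ.+-identityˡ _ ⟩
    c * g i ∎

⟦⟧ₒ-ΣRev : ∀ d (L : Operator) → Degree< d L → (f : ℕ → ℤ) → ∀ n →
           ⟦ L ⟧ₒ f n ≡ ΣRev d (λ k → coefficient L k * f (n ℕ.+ k))
⟦⟧ₒ-ΣRev d [] [] f n = sym (trans (ΣFin-cong d (λ j → ℤ.*-zeroˡ (f (n ℕ.+ (d ∸ suc (toℕ j)))))) (ΣRev-zero d))
⟦⟧ₒ-ΣRev d ((c , i , _) ∷ L) (i<d ∷ L-degree) f n = begin
  c * f (n ℕ.+ i) + ⟦ L ⟧ₒ f n
    ≡⟨ cong₂ _+_ (sym (ΣRev-single d i<d c (λ k → f (n ℕ.+ k)))) (⟦⟧ₒ-ΣRev d L L-degree f n) ⟩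
  ΣRev d (λ k → single i c k * f (n ℕ.+ k)) + ΣRev d (λ k → coefficient L k * f (n ℕ.+ k))
    ≡⟨ ΣRev-+ d (λ k → single i c k * f (n ℕ.+ k)) (λ k → coefficient L k * f (n ℕ.+ k)) ⟨
  ΣRev d (λ k → single i c k * f (n ℕ.+ k) + coefficient L k * f (n ℕ.+ k))
    ≡⟨ ΣFin-cong d (λ j → ℤ.*-distribʳ-+ _ (single i c _) (coefficient L _)) ⟨
  ΣRev d (λ k → coefficient ((c , i , tt) ∷ L) k * f (n ℕ.+ k)) ∎

annihilated⇒recurrence : ∀ d (L : Operator) → Degree< d L → (a : ℕ → ℤ) →
                         (∀ n → ⟦ monic d L ⟧ₒ a n ≡ 0ℤ) → SatisfiesLinearRecurrence a
annihilated⇒recurrence d L L-degree a annihilated = d , (λ j → coefficient −L (d ∸ suc (toℕ j))) , recurrence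
  where
  −L : Operator
  −L = scaleShift (-1ℤ , 0) L

  solve-leading : ∀ y z → 1ℤ * y + z ≡ 0ℤ → y ≡ -1ℤ * z
  solve-leading y z eq = begin
    y                      ≡⟨ lemma y z ⟩
    1ℤ * y + z + -1ℤ * z   ≡⟨ cong (_+ -1ℤ * z) eq ⟩
    0ℤ + -1ℤ * z           ≡⟨ ℤ.+-identityˡ _ ⟩
    -1ℤ * z                ∎
    where lemma : ∀ y z → y ≡ 1ℤ * y + z + -1ℤ * z
          lemma = solve-∀

  recurrence : ∀ n → a (n ℕ.+ d) ≡ ΣFin d (λ j → coefficient −L (d ∸ suc (toℕ j)) * a (n ℕ.+ d ∸ suc (toℕ j)))
  recurrence n = begin
    a (n ℕ.+ d)     ≡⟨ solve-leading (a (n ℕ.+ d)) (⟦ L ⟧ₒ a n) (annihilated n) ⟩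
    -1ℤ * ⟦ L ⟧ₒ a n ≡⟨ ⟦scale⟧ -1ℤ L (λ _ → a) n ⟨
    ⟦ −L ⟧ₒ a n      ≡⟨ ⟦⟧ₒ-ΣRev d −L (scaleShift-degree< -1ℤ 0 L L-degree) a n ⟩
    ΣRev d (λ k → coefficient −L k * a (n ℕ.+ k))
      ≡⟨ ΣFin-cong d (λ j → cong (λ k → coefficient −L (d ∸ suc (toℕ j)) * a k)
                                 (ℕ.+-∸-assoc n (Fin.toℕ<n j))) ⟨
    ΣFin d (λ j → coefficient −L (d ∸ suc (toℕ j)) * a (n ℕ.+ d ∸ suc (toℕ j))) ∎

record LinearRealization (a : ℕ → ℤ) : Set₁ where
  field
    State      : Set
    states     : List State
    transition : State → State → ℤ
    x          : State → ℕ → ℤ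
    x-suc      : ∀ s n → x s (suc n) ≡ ∑ states (λ r → transition s r * x r n)
    outputs    : List State
    weight     : State → ℤ
    output     : ∀ n → a n ≡ ∑ outputs (λ s → weight s * x s n)

realization⇒recurrence : {a : ℕ → ℤ} → LinearRealization a → SatisfiesLinearRecurrence a
realization⇒recurrence {a} R =
  annihilated⇒recurrence degree lower lower-degree a annihilated
  where
  open LinearRealization R
  open AnnihilatorModulo (eliminate transition states x (λ _ _ → 0ℤ)
                                    (λ s n → trans (x-suc s n) (sym (ℤ.+-identityʳ _))))
  annihilated : ∀ n → ⟦ monic degree lower ⟧ₒ a n ≡ 0ℤ
  annihilated n = begin
    ⟦ monic degree lower ⟧ₒ a n
      ≡⟨ ⟦⟧-cong (monic degree lower) (λ _ → output) n ⟩
    ⟦ monic degree lower ⟧ₒ (λ m → ∑ outputs (λ s → weight s * x s m)) n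
      ≡⟨ ⟦⟧-∑ (monic degree lower) outputs (λ s _ m → weight s * x s m) n ⟩
    ∑ outputs (λ s → ⟦ monic degree lower ⟧ₒ (λ m → weight s * x s m) n)
      ≡⟨ ∑-cong outputs (λ s → trans (⟦⟧ₒ-* (monic degree lower) (weight s) (x s) n)
           (trans (cong (weight s *_) (trans (annihilates s n) (⟦⟧-zero (residue s) n))) (ℤ.*-zeroʳ (weight s)))) ⟩
    ∑ outputs (λ _ → 0ℤ)
      ≡⟨ ∑-zero outputs ⟩
    0ℤ ∎

realization-cong : {a b : ℕ → ℤ} → (∀ n → a n ≡ b n) → LinearRealization a → LinearRealization b
realization-cong a≗b R = record
  { State = State ; states = states ; transition = transition ; x = x ; x-suc = x-suc
  ; outputs = outputs ; weight = weight ; output = λ n → trans (sym (a≗b n)) (output n) }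
  where open LinearRealization R

realization-one : LinearRealization (λ _ → 1ℤ)
realization-one = record
  { State = ⊤ ; states = tt ∷ [] ; transition = λ _ _ → 1ℤ ; x = λ _ _ → 1ℤ ; x-suc = λ _ _ → refl
  ; outputs = tt ∷ [] ; weight = λ _ → 1ℤ ; output = λ _ → refl }

realization-* : {a b : ℕ → ℤ} → LinearRealization a → LinearRealization b → LinearRealization (λ n → a n * b n)
realization-* {a} {b} R₁ R₂ = record
  { State = R₁.State × R₂.State
  ; states = cartesianProduct R₁.states R₂.states
  ; transition = λ (s₁ , s₂) (r₁ , r₂) → R₁.transition s₁ r₁ * R₂.transition s₂ r₂
  ; x = λ (s₁ , s₂) n → R₁.x s₁ n * R₂.x s₂ n
  ; x-suc = λ (s₁ , s₂) n → trans (cong₂ _*_ (R₁.x-suc s₁ n) (R₂.x-suc s₂ n))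
                                  (∑-tensor R₁.states R₂.states (R₁.transition s₁) (λ r₁ → R₁.x r₁ n)
                                                                (R₂.transition s₂) (λ r₂ → R₂.x r₂ n))
  ; outputs = cartesianProduct R₁.outputs R₂.outputs
  ; weight = λ (s₁ , s₂) → R₁.weight s₁ * R₂.weight s₂
  ; output = λ n → trans (cong₂ _*_ (R₁.output n) (R₂.output n))
                         (∑-tensor R₁.outputs R₂.outputs R₁.weight (λ s₁ → R₁.x s₁ n) R₂.weight (λ s₂ → R₂.x s₂ n))
  }
  where
  module R₁ = LinearRealization R₁
  module R₂ = LinearRealization R₂

  ∑-tensor : {S₁ S₂ : Set} (xs : List S₁) (ys : List S₂) (p q : S₁ → ℤ) (r s : S₂ → ℤ) →
             ∑ xs (λ i → p i * q i) * ∑ ys (λ j → r j * s j) ≡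
             ∑ (cartesianProduct xs ys) (λ (i , j) → p i * r j * (q i * s j))
  ∑-tensor xs ys p q r s = begin
    ∑ xs (λ i → p i * q i) * ∑ ys (λ j → r j * s j)
      ≡⟨ ∑-cartesianProduct xs ys (λ i → p i * q i) (λ j → r j * s j) ⟨
    ∑ (cartesianProduct xs ys) (λ (i , j) → p i * q i * (r j * s j))
      ≡⟨ ∑-cong (cartesianProduct xs ys) (λ (i , j) → interchange (p i) (q i) (r j) (s j)) ⟩
    ∑ (cartesianProduct xs ys) (λ (i , j) → p i * r j * (q i * s j)) ∎
    where interchange : ∀ a b c d → a * b * (c * d) ≡ a * c * (b * d)
          interchange = solve-∀

realization-^ : {a : ℕ → ℤ} → LinearRealization a → ∀ t → LinearRealization (λ n → a n ^ℤ t)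
realization-^ R zero    = realization-one
realization-^ R (suc t) = realization-* R (realization-^ R t)

-- An extra state, live only at time 0, prepends the value a 0.
realization-pred : {a : ℕ → ℤ} → LinearRealization (λ n → a (suc n)) → LinearRealization a
realization-pred {a} R = record
  { State = Maybe State
  ; states = nothing ∷ map just states
  ; transition = transition′
  ; x = x′
  ; x-suc = x′-suc
  ; outputs = nothing ∷ map just outputs
  ; weight = weight′
  ; output = output′
  }
  where
  open LinearRealization R

  x′ : Maybe State → ℕ → ℤ
  x′ nothing  zero    = 1ℤ
  x′ nothing  (suc n) = 0ℤ
  x′ (just s) zero    = 0ℤ
  x′ (just s) (suc n) = x s n

  transition′ : Maybe State → Maybe State → ℤ
  transition′ nothing  _        = 0ℤ
  transition′ (just s) nothing  = x s 0
  transition′ (just s) (just r) = transition s r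

  weight′ : Maybe State → ℤ
  weight′ nothing  = a 0
  weight′ (just s) = weight s

  ∑-outputs′ : ∀ n → ∑ (nothing ∷ map just outputs) (λ s → weight′ s * x′ s n)
                     ≡ a 0 * x′ nothing n + ∑ outputs (λ s → weight s * x′ (just s) n)
  ∑-outputs′ n = cong (_+_ (a 0 * x′ nothing n)) (∑-map just outputs (λ s → weight′ s * x′ s n))

  output′ : ∀ n → a n ≡ ∑ (nothing ∷ map just outputs) (λ s → weight′ s * x′ s n)
  output′ zero = sym (begin
    ∑ (nothing ∷ map just outputs) (λ s → weight′ s * x′ s 0)
      ≡⟨ ∑-outputs′ 0 ⟩
    a 0 * 1ℤ + ∑ outputs (λ s → weight s * 0ℤ)
      ≡⟨ cong₂ _+_ (ℤ.*-identityʳ (a 0)) (trans (∑-cong outputs (λ s → ℤ.*-zeroʳ (weight s))) (∑-zero outputs)) ⟩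
    a 0 + 0ℤ
      ≡⟨ ℤ.+-identityʳ (a 0) ⟩
    a 0 ∎)
  output′ (suc n) = trans (output n) (sym (begin
    ∑ (nothing ∷ map just outputs) (λ s → weight′ s * x′ s (suc n))
      ≡⟨ ∑-outputs′ (suc n) ⟩
    a 0 * 0ℤ + ∑ outputs (λ s → weight s * x s n)
      ≡⟨ cong (_+ ∑ outputs (λ s → weight s * x s n)) (ℤ.*-zeroʳ (a 0)) ⟩
    0ℤ + ∑ outputs (λ s → weight s * x s n)
      ≡⟨ ℤ.+-identityˡ _ ⟩
    ∑ outputs (λ s → weight s * x s n) ∎))

  ∑-states′ : ∀ s n → ∑ (nothing ∷ map just states) (λ r → transition′ (just s) r * x′ r n)
                      ≡ x s 0 * x′ nothing n + ∑ states (λ r → transition s r * x′ (just r) n)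
  ∑-states′ s n = cong (_+_ (x s 0 * x′ nothing n)) (∑-map just states (λ r → transition′ (just s) r * x′ r n))

  x′-suc : ∀ s n → x′ s (suc n) ≡ ∑ (nothing ∷ map just states) (λ r → transition′ s r * x′ r n)
  x′-suc nothing  n       = sym (∑-zero (nothing ∷ map just states))
  x′-suc (just s) zero    = sym (begin
    ∑ (nothing ∷ map just states) (λ r → transition′ (just s) r * x′ r 0)
      ≡⟨ ∑-states′ s 0 ⟩
    x s 0 * 1ℤ + ∑ states (λ r → transition s r * 0ℤ)
      ≡⟨ cong₂ _+_ (ℤ.*-identityʳ (x s 0)) (trans (∑-cong states (λ r → ℤ.*-zeroʳ (transition s r))) (∑-zero states)) ⟩
    x s 0 + 0ℤ
      ≡⟨ ℤ.+-identityʳ _ ⟩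
    x s 0 ∎)
  x′-suc (just s) (suc n) = trans (x-suc s n) (sym (begin
    ∑ (nothing ∷ map just states) (λ r → transition′ (just s) r * x′ r (suc n))
      ≡⟨ ∑-states′ s (suc n) ⟩
    x s 0 * 0ℤ + ∑ states (λ r → transition s r * x r n)
      ≡⟨ cong (_+ ∑ states (λ r → transition s r * x r n)) (ℤ.*-zeroʳ (x s 0)) ⟩
    0ℤ + ∑ states (λ r → transition s r * x r n)
      ≡⟨ ℤ.+-identityˡ _ ⟩
    ∑ states (λ r → transition s r * x r n) ∎))

𝟙 : Bool → ℤ
𝟙 true  = 1ℤ
𝟙 false = 0ℤ

length-filter : {P : A → Set} (P? : ∀ x → Dec (P x)) (xs : List A) →
                + length (filter P? xs) ≡ ∑ xs (λ x → 𝟙 (does (P? x)))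
length-filter P? []       = refl
length-filter P? (x ∷ xs) with does (P? x)
... | true  = trans (ℤ.pos-+ 1 (length (filter P? xs))) (cong (_+_ 1ℤ) (length-filter P? xs))
... | false = trans (length-filter P? xs) (sym (ℤ.+-identityˡ _))

𝟙-all? : {P : A → Set} (P? : ∀ x → Dec (P x)) (xs : List A) → 𝟙 (does (all? P? xs)) ≡ Π xs (λ x → 𝟙 (does (P? x)))
𝟙-all? P? []       = refl
𝟙-all? P? (x ∷ xs) with does (P? x)
... | true  = trans (𝟙-all? P? xs) (sym (ℤ.*-identityˡ _))
... | false = refl

does-⇔ : {P Q : Set} (P? : Dec P) (Q? : Dec Q) → (P → Q) → (Q → P) → does P? ≡ does Q?
does-⇔ (yes _) (yes _) _   _   = refl
does-⇔ (yes p) (no ¬q) P⇒Q _   = contradiction (P⇒Q p) ¬q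
does-⇔ (no ¬p) (yes q) _   Q⇒P = contradiction (Q⇒P q) ¬p
does-⇔ (no _)  (no _)  _   _   = refl

Labelled : Set
Labelled = List (Edge × ℕ)

Incident : Vertex → Edge → Set
Incident v (a , b) = a ≡ v ⊎ b ≡ v

-- vertexSum m n ℓ v is labelSum (zip (edges m n) (toList ℓ)) v by definition.
labelSum : Labelled → Vertex → ℕ
labelSum Z v = sum (map proj₂ (filter (λ (e , _) → incident? v e) Z))

labelSum-∷ : ∀ e l Z v → labelSum ((e , l) ∷ Z) v ≡ (if does (incident? v e) then l else 0) ℕ.+ labelSum Z v
labelSum-∷ e l Z v with does (incident? v e)
... | true  = refl
... | false = refl

labelSum-++ : ∀ Z₁ Z₂ v → labelSum (Z₁ ++ Z₂) v ≡ labelSum Z₁ v ℕ.+ labelSum Z₂ v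
labelSum-++ Z₁ Z₂ v = begin
  sum (map proj₂ (filter _ (Z₁ ++ Z₂)))                        ≡⟨ cong (sum ∘ map proj₂) (List.filter-++ _ Z₁ Z₂) ⟩
  sum (map proj₂ (filter _ Z₁ ++ filter _ Z₂))                 ≡⟨ cong sum (List.map-++ proj₂ (filter _ Z₁) _) ⟩
  sum (map proj₂ (filter _ Z₁) ++ map proj₂ (filter _ Z₂))     ≡⟨ sum-++ (map proj₂ (filter _ Z₁)) _ ⟩
  labelSum Z₁ v ℕ.+ labelSum Z₂ v                              ∎

labelSum-nonincident : ∀ v (es : List Edge) → All (¬_ ∘ Incident v) es → ∀ ls → labelSum (zip es ls) v ≡ 0
labelSum-nonincident v []       []           ls       = refl
labelSum-nonincident v (e ∷ es) (¬inc ∷ ¬incs) []       = refl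
labelSum-nonincident v (e ∷ es) (¬inc ∷ ¬incs) (l ∷ ls) =
  trans (cong (sum ∘ map proj₂) (List.filter-reject (λ (e , _) → incident? v e) ¬inc))
        (labelSum-nonincident v es ¬incs ls)

labelSum-zeros : ∀ v (es : List Edge) n → labelSum (zip es (replicate n 0)) v ≡ 0
labelSum-zeros v []       n       = refl
labelSum-zeros v (e ∷ es) zero    = refl
labelSum-zeros v (e ∷ es) (suc n) = trans (labelSum-∷ e 0 _ v) (trans (cong (ℕ._+ _) (if-0 (does (incident? v e))))
                                                                      (labelSum-zeros v es n))
  where if-0 : ∀ b → (if b then 0 else 0) ≡ 0
        if-0 true  = refl
        if-0 false = refl

shiftVertex : ℕ → Vertex → Vertex
shiftVertex k (i , j) = (i ℕ.+ k , j)

shiftEdge : ℕ → Edge → Edge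
shiftEdge k (a , b) = (shiftVertex k a , shiftVertex k b)

incident?-shift : ∀ k v e → does (incident? (shiftVertex k v) (shiftEdge k e)) ≡ does (incident? v e)
incident?-shift k v (a , b) = does-⇔ (incident? (shiftVertex k v) (shiftEdge k (a , b))) (incident? v (a , b)) unshift shift
  where
  shiftVertex-injective : ∀ {u w} → shiftVertex k u ≡ shiftVertex k w → u ≡ w
  shiftVertex-injective {i , _} {i′ , _} eq = cong₂ _,_ (ℕ.+-cancelʳ-≡ k i i′ (cong proj₁ eq)) (cong proj₂ eq)
  unshift : Incident (shiftVertex k v) (shiftEdge k (a , b)) → Incident v (a , b)
  unshift (inj₁ eq) = inj₁ (shiftVertex-injective eq)
  unshift (inj₂ eq) = inj₂ (shiftVertex-injective eq)
  shift : Incident v (a , b) → Incident (shiftVertex k v) (shiftEdge k (a , b))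
  shift (inj₁ eq) = inj₁ (cong (shiftVertex k) eq)
  shift (inj₂ eq) = inj₂ (cong (shiftVertex k) eq)

labelSum-shift : ∀ k v (es : List Edge) ls → labelSum (zip (map (shiftEdge k) es) ls) (shiftVertex k v) ≡ labelSum (zip es ls) v
labelSum-shift k v []       ls       = refl
labelSum-shift k v (e ∷ es) []       = refl
labelSum-shift k v (e ∷ es) (l ∷ ls) = begin
  labelSum ((shiftEdge k e , l) ∷ zip (map (shiftEdge k) es) ls) (shiftVertex k v)
    ≡⟨ labelSum-∷ (shiftEdge k e) l _ (shiftVertex k v) ⟩
  (if does (incident? (shiftVertex k v) (shiftEdge k e)) then l else 0) ℕ.+ labelSum (zip (map (shiftEdge k) es) ls) (shiftVertex k v)
    ≡⟨ cong₂ (λ b s → (if b then l else 0) ℕ.+ s) (incident?-shift k v e) (labelSum-shift k v es ls) ⟩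
  (if does (incident? v e) then l else 0) ℕ.+ labelSum (zip es ls) v
    ≡⟨ labelSum-∷ e l _ v ⟨
  labelSum ((e , l) ∷ zip es ls) v ∎

InColumns : (ℕ → Set) → Edge → Set
InColumns P ((i , _) , (i′ , _)) = P i × P i′

outside⇒nonincident : {P : ℕ → Set} {i j : ℕ} → ¬ P i → ∀ {e} → InColumns P e → ¬ Incident (i , j) e
outside⇒nonincident ¬Pi (Pa , _)  (inj₁ refl) = ¬Pi Pa
outside⇒nonincident ¬Pi (_  , Pb) (inj₂ refl) = ¬Pi Pb

labelSum-outside : {P : ℕ → Set} {i : ℕ} → ¬ P i → (es : List Edge) → All (InColumns P) es →
                   ∀ j ls → labelSum (zip es ls) (i , j) ≡ 0
labelSum-outside ¬Pi es inP j = labelSum-nonincident (_ , j) es (All.map (outside⇒nonincident ¬Pi) inP)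

δ : ℕ → ℕ → ℤ
δ a b = 𝟙 (does (a ℕ.≟ b))

module Labellings (t : ℕ) where

  magicWeight : Labelled → List Vertex → ℤ
  magicWeight Z vs = Π vs (λ v → δ (labelSum Z v) t)

  magicWeight-cong : ∀ Z Z′ vs → All (λ v → labelSum Z v ≡ labelSum Z′ v) vs → magicWeight Z vs ≡ magicWeight Z′ vs
  magicWeight-cong Z Z′ vs eqs = Π-cong (All.map (cong (λ a → δ a t)) eqs)

  ∑ₗ : List Edge → (Labelled → ℤ) → ℤ
  ∑ₗ es G = ∑ (boundedVecs (length es) t) (λ ℓ → G (zip es (toList ℓ)))

  ∑ₗ-cong : ∀ es {G G′ : Labelled → ℤ} → (∀ ls → G (zip es ls) ≡ G′ (zip es ls)) → ∑ₗ es G ≡ ∑ₗ es G′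
  ∑ₗ-cong es G≗G′ = ∑-cong (boundedVecs (length es) t) (λ ℓ → G≗G′ (toList ℓ))

  ∑-boundedVecs-+ : ∀ a b (F : List ℕ → ℤ) →
    ∑ (boundedVecs (a ℕ.+ b) t) (λ ℓ → F (toList ℓ)) ≡
    ∑ (boundedVecs a t) (λ ℓ₁ → ∑ (boundedVecs b t) (λ ℓ₂ → F (toList ℓ₁ ++ toList ℓ₂)))
  ∑-boundedVecs-+ zero    b F = sym (ℤ.+-identityʳ _)
  ∑-boundedVecs-+ (suc a) b F = begin
    ∑ (concatMap (λ x → map (x Vec.∷_) (boundedVecs (a ℕ.+ b) t)) (upTo (suc t))) (λ ℓ → F (toList ℓ))
      ≡⟨ ∑-concatMap (λ x → map (x Vec.∷_) (boundedVecs (a ℕ.+ b) t)) (upTo (suc t)) (λ ℓ → F (toList ℓ)) ⟩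
    ∑ (upTo (suc t)) (λ x → ∑ (map (x Vec.∷_) (boundedVecs (a ℕ.+ b) t)) (λ ℓ → F (toList ℓ)))
      ≡⟨ ∑-cong (upTo (suc t)) (λ x → trans (∑-map (x Vec.∷_) (boundedVecs (a ℕ.+ b) t) (λ ℓ → F (toList ℓ))) (trans (∑-boundedVecs-+ a b (F ∘ (x ∷_)))
           (sym (∑-map (x Vec.∷_) (boundedVecs a t) (λ ℓ₁ → ∑ (boundedVecs b t) (λ ℓ₂ → F (toList ℓ₁ ++ toList ℓ₂))))))) ⟩
    ∑ (upTo (suc t)) (λ x → ∑ (map (x Vec.∷_) (boundedVecs a t))
                              (λ ℓ₁ → ∑ (boundedVecs b t) (λ ℓ₂ → F (toList ℓ₁ ++ toList ℓ₂))))
      ≡⟨ ∑-concatMap (λ x → map (x Vec.∷_) (boundedVecs a t)) (upTo (suc t))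
                     (λ ℓ₁ → ∑ (boundedVecs b t) (λ ℓ₂ → F (toList ℓ₁ ++ toList ℓ₂))) ⟨
    ∑ (concatMap (λ x → map (x Vec.∷_) (boundedVecs a t)) (upTo (suc t)))
      (λ ℓ₁ → ∑ (boundedVecs b t) (λ ℓ₂ → F (toList ℓ₁ ++ toList ℓ₂))) ∎

  ∑-boundedVecs-cast : ∀ {a b} → a ≡ b → (F : List ℕ → ℤ) →
                       ∑ (boundedVecs a t) (λ ℓ → F (toList ℓ)) ≡ ∑ (boundedVecs b t) (λ ℓ → F (toList ℓ))
  ∑-boundedVecs-cast refl F = refl

  ∑ₗ-++ : ∀ es₁ es₂ (G : Labelled → ℤ) → ∑ₗ (es₁ ++ es₂) G ≡ ∑ₗ es₁ (λ Z₁ → ∑ₗ es₂ (λ Z₂ → G (Z₁ ++ Z₂)))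
  ∑ₗ-++ es₁ es₂ G = begin
    ∑ₗ (es₁ ++ es₂) G
      ≡⟨ ∑-boundedVecs-cast (List.length-++ es₁) (G ∘ zip (es₁ ++ es₂)) ⟩
    ∑ (boundedVecs (length es₁ ℕ.+ length es₂) t) (λ ℓ → G (zip (es₁ ++ es₂) (toList ℓ)))
      ≡⟨ ∑-boundedVecs-+ (length es₁) (length es₂) (G ∘ zip (es₁ ++ es₂)) ⟩
    ∑ (boundedVecs (length es₁) t) (λ ℓ₁ → ∑ (boundedVecs (length es₂) t) (λ ℓ₂ → G (zip (es₁ ++ es₂) (toList ℓ₁ ++ toList ℓ₂))))
      ≡⟨ ∑-cong (boundedVecs (length es₁) t) (λ ℓ₁ → ∑-cong (boundedVecs (length es₂) t) (λ ℓ₂ → cong G (zip-++ es₁ es₂ (toList ℓ₁) (toList ℓ₂) (sym (Vec.length-toList ℓ₁))))) ⟩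
    ∑ₗ es₁ (λ Z₁ → ∑ₗ es₂ (λ Z₂ → G (Z₁ ++ Z₂))) ∎

module Grid (m t : ℕ) where

  open Labellings t

  T-as-∑ₗ : ∀ n → + T m n t ≡ ∑ₗ (edges m n) (λ Z → magicWeight Z (vertices m n))
  T-as-∑ₗ n = trans (length-filter (isMagic? m n t) (boundedVecs (length (edges m n)) t))
                    (∑-cong (boundedVecs (length (edges m n)) t) (λ ℓ → 𝟙-all? (λ v → vertexSum m n ℓ v ℕ.≟ t) (vertices m n)))

  rungs : ℕ → List Edge
  rungs i = map (λ j → ((i , j) , (suc i , j))) (upTo m)

  verticals : ℕ → List Edge
  verticals i = map (λ j → ((i , j) , (i , suc j))) (upTo (m ∸ 1))

  column : ℕ → List Vertex
  column i = map (λ j → (i , j)) (upTo m)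

  edges-suc : ∀ k → edges m (suc (suc k)) ≡ (hEdges m (suc k) ++ rungs k) ++ (vEdges m (suc k) ++ verticals (suc k))
  edges-suc k = cong₂ _++_ (concatMap-upTo-suc rungs k) (concatMap-upTo-suc verticals (suc k))

  vertices-suc : ∀ k → vertices m (suc (suc k)) ≡ vertices m (suc k) ++ column (suc k)
  vertices-suc k = concatMap-upTo-suc column (suc k)

  hEdges-before : ∀ k → All (InColumns (_< suc k)) (hEdges m (suc k))
  hEdges-before k = All-concatMap-upTo k rungs (λ i i<k → All-map-upTo m _ (λ _ _ → ℕ.m<n⇒m<1+n i<k , s≤s i<k))

  vEdges-before : ∀ k → All (InColumns (_< suc k)) (vEdges m (suc k))
  vEdges-before k = All-concatMap-upTo (suc k) verticals (λ i i<1+k → All-map-upTo (m ∸ 1) _ (λ _ _ → i<1+k , i<1+k))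

  rungs-after : ∀ k → All (InColumns (suc k ≤_)) (rungs (suc k))
  rungs-after k = All-map-upTo m _ (λ _ _ → ℕ.≤-refl , ℕ.n≤1+n (suc k))

  verticals-after : ∀ k → All (InColumns (suc k ≤_)) (verticals (suc k))
  verticals-after k = All-map-upTo (m ∸ 1) _ (λ _ _ → ℕ.≤-refl , ℕ.≤-refl)

  vertices-before : ∀ k → All (λ v → proj₁ v < suc k) (vertices m (suc k))
  vertices-before k = All-concatMap-upTo (suc k) column (λ i i<1+k → All-map-upTo m _ (λ _ _ → i<1+k))

  rungs-shift : ∀ k i → rungs (i ℕ.+ k) ≡ map (shiftEdge k) (rungs i)
  rungs-shift k i = List.map-∘ (upTo m)

  verticals-shift : ∀ k i → verticals (i ℕ.+ k) ≡ map (shiftEdge k) (verticals i)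
  verticals-shift k i = List.map-∘ (upTo (m ∸ 1))

  length-rungs : ∀ i → length (rungs i) ≡ m
  length-rungs i = trans (List.length-map _ (upTo m)) (List.length-upTo m)

  length-verticals : ∀ i → length (verticals i) ≡ m ∸ 1
  length-verticals i = trans (List.length-map _ (upTo (m ∸ 1))) (List.length-upTo (m ∸ 1))

  extendedCount : ℕ → List ℕ → ℤ
  extendedCount k ly = ∑ₗ (edges m (suc k)) (λ Z → magicWeight (Z ++ zip (rungs k) ly) (vertices m (suc k)))

  transfer : List ℕ → List ℕ → ℤ
  transfer lz ly = ∑ₗ (verticals 1) (λ W → magicWeight (zip (rungs 0) lz ++ W ++ zip (rungs 1) ly) (column 1))

  columnLabellings : List (List ℕ)
  columnLabellings = map toList (boundedVecs m t)

  ∑-rungLabellings : ∀ k (F : List ℕ → ℤ) → ∑ (boundedVecs (length (rungs k)) t) (λ ℓ → F (toList ℓ)) ≡ ∑ columnLabellings F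
  ∑-rungLabellings k F = trans (∑-boundedVecs-cast (length-rungs k) F) (sym (∑-map toList (boundedVecs m t) F))

  T-extendedCount : ∀ k → + T m (suc k) t ≡ extendedCount k (replicate m 0)
  T-extendedCount k = trans (T-as-∑ₗ (suc k)) (∑ₗ-cong (edges m (suc k))
    {λ Z → magicWeight Z (vertices m (suc k))} {λ Z → magicWeight (Z ++ Z⁰) (vertices m (suc k))}
    (λ ls → magicWeight-cong (zip (edges m (suc k)) ls) (zip (edges m (suc k)) ls ++ Z⁰) (vertices m (suc k))
                             (All.tabulate (λ {v} _ → sym (zero-rungs (zip (edges m (suc k)) ls) v)))))
    where
    Z⁰ = zip (rungs k) (replicate m 0)
    zero-rungs : ∀ Z v → labelSum (Z ++ Z⁰) v ≡ labelSum Z v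
    zero-rungs Z v = trans (labelSum-++ Z Z⁰ v)
                           (trans (cong (labelSum Z v ℕ.+_) (labelSum-zeros v (rungs k) m)) (ℕ.+-identityʳ _))

  module ColumnStep (k : ℕ) (l₁ l₂ l₃ l₄ ly : List ℕ) where
    Z₁ Z₂ Z₃ Z₄ Y : Labelled
    Z₁ = zip (hEdges m (suc k)) l₁
    Z₂ = zip (rungs k) l₂
    Z₃ = zip (vEdges m (suc k)) l₃
    Z₄ = zip (verticals (suc k)) l₄
    Y  = zip (rungs (suc k)) ly

    whole old new : Labelled
    whole = ((Z₁ ++ Z₂) ++ (Z₃ ++ Z₄)) ++ Y
    old   = (Z₁ ++ Z₃) ++ Z₂
    new   = zip (rungs 0) l₂ ++ zip (verticals 1) l₄ ++ zip (rungs 1) ly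

    labelSum-whole : ∀ v → labelSum whole v ≡
      labelSum Z₁ v ℕ.+ labelSum Z₂ v ℕ.+ (labelSum Z₃ v ℕ.+ labelSum Z₄ v) ℕ.+ labelSum Y v
    labelSum-whole v = trans (labelSum-++ ((Z₁ ++ Z₂) ++ (Z₃ ++ Z₄)) Y v) (cong (ℕ._+ labelSum Y v)
      (trans (labelSum-++ (Z₁ ++ Z₂) (Z₃ ++ Z₄) v) (cong₂ ℕ._+_ (labelSum-++ Z₁ Z₂ v) (labelSum-++ Z₃ Z₄ v))))

    old-vertex : ∀ v → proj₁ v < suc k → labelSum whole v ≡ labelSum old v
    old-vertex (i , j) i<1+k = begin
      labelSum whole (i , j)
        ≡⟨ labelSum-whole (i , j) ⟩
      a ℕ.+ b ℕ.+ (c ℕ.+ labelSum Z₄ (i , j)) ℕ.+ labelSum Y (i , j)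
        ≡⟨ cong₂ (λ d e → a ℕ.+ b ℕ.+ (c ℕ.+ d) ℕ.+ e)
                 (labelSum-outside (ℕ.<⇒≱ i<1+k) (verticals (suc k)) (verticals-after k) j l₄)
                 (labelSum-outside (ℕ.<⇒≱ i<1+k) (rungs (suc k)) (rungs-after k) j ly) ⟩
      a ℕ.+ b ℕ.+ (c ℕ.+ 0) ℕ.+ 0
        ≡⟨ lemma a b c ⟩
      a ℕ.+ c ℕ.+ b
        ≡⟨ trans (labelSum-++ (Z₁ ++ Z₃) Z₂ (i , j)) (cong (ℕ._+ b) (labelSum-++ Z₁ Z₃ (i , j))) ⟨
      labelSum old (i , j) ∎
      where
      a = labelSum Z₁ (i , j)
      b = labelSum Z₂ (i , j)
      c = labelSum Z₃ (i , j)
      lemma : ∀ a b c → a ℕ.+ b ℕ.+ (c ℕ.+ 0) ℕ.+ 0 ≡ a ℕ.+ c ℕ.+ b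
      lemma = ℕ-Solver.solve-∀

    -- Column k + 1 of G(m, k + 2) is column 1 shifted by k.
    translate : ∀ {es} es₀ → es ≡ map (shiftEdge k) es₀ → ∀ ls j → labelSum (zip es ls) (suc k , j) ≡ labelSum (zip es₀ ls) (1 , j)
    translate es₀ refl ls j = labelSum-shift k (1 , j) es₀ ls

    new-vertex : ∀ j → labelSum whole (suc k , j) ≡ labelSum new (1 , j)
    new-vertex j = begin
      labelSum whole (suc k , j)
        ≡⟨ labelSum-whole (suc k , j) ⟩
      labelSum Z₁ (suc k , j) ℕ.+ b ℕ.+ (labelSum Z₃ (suc k , j) ℕ.+ d) ℕ.+ e
        ≡⟨ cong₂ (λ a c → a ℕ.+ b ℕ.+ (c ℕ.+ d) ℕ.+ e)
                 (labelSum-outside (ℕ.n≮n (suc k)) (hEdges m (suc k)) (hEdges-before k) j l₁)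
                 (labelSum-outside (ℕ.n≮n (suc k)) (vEdges m (suc k)) (vEdges-before k) j l₃) ⟩
      0 ℕ.+ b ℕ.+ (0 ℕ.+ d) ℕ.+ e
        ≡⟨ ℕ.+-assoc b d e ⟩
      b ℕ.+ (d ℕ.+ e)
        ≡⟨ cong₂ (λ b′ de → b′ ℕ.+ de) (translate (rungs 0) (rungs-shift k 0) l₂ j)
             (cong₂ ℕ._+_ (translate (verticals 1) (verticals-shift k 1) l₄ j) (translate (rungs 1) (rungs-shift k 1) ly j)) ⟩
      labelSum (zip (rungs 0) l₂) (1 , j) ℕ.+ (labelSum (zip (verticals 1) l₄) (1 , j) ℕ.+ labelSum (zip (rungs 1) ly) (1 , j))
        ≡⟨ trans (labelSum-++ (zip (rungs 0) l₂) _ (1 , j)) (cong (_ ℕ.+_) (labelSum-++ (zip (verticals 1) l₄) _ (1 , j))) ⟨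
      labelSum new (1 , j) ∎
      where
      b = labelSum Z₂ (suc k , j)
      d = labelSum Z₄ (suc k , j)
      e = labelSum Y (suc k , j)

    magicWeight-split : magicWeight whole (vertices m (suc (suc k))) ≡ magicWeight old (vertices m (suc k)) * magicWeight new (column 1)
    magicWeight-split = begin
      magicWeight whole (vertices m (suc (suc k)))
        ≡⟨ cong (magicWeight whole) (vertices-suc k) ⟩
      magicWeight whole (vertices m (suc k) ++ column (suc k))
        ≡⟨ Π-++ (vertices m (suc k)) (column (suc k)) _ ⟩
      magicWeight whole (vertices m (suc k)) * magicWeight whole (column (suc k))
        ≡⟨ cong₂ _*_ (magicWeight-cong whole old (vertices m (suc k)) (All.map (λ {v} → old-vertex v) (vertices-before k)))
                     (trans (Π-map (λ j → (suc k , j)) (upTo m) (λ v → δ (labelSum whole v) t))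
                       (trans (Π-cong {xs = upTo m} (All.tabulate (λ {j} _ → cong (λ a → δ a t) (new-vertex j))))
                              (sym (Π-map (λ j → (1 , j)) (upTo m) (λ v → δ (labelSum new v) t))))) ⟩
      magicWeight old (vertices m (suc k)) * magicWeight new (column 1) ∎

  extendedCount-suc : ∀ k ly → extendedCount (suc k) ly ≡ ∑ columnLabellings (λ lz → transfer lz ly * extendedCount k lz)
  extendedCount-suc k ly = begin
    extendedCount (suc k) ly
      ≡⟨ cong (λ es → ∑ₗ es F) (edges-suc k) ⟩
    ∑ₗ ((H ++ R) ++ (V ++ W)) F
      ≡⟨ ∑ₗ-++ (H ++ R) (V ++ W) F ⟩
    ∑ₗ (H ++ R) (λ Z₁₂ → ∑ₗ (V ++ W) (λ Z₃₄ → F (Z₁₂ ++ Z₃₄)))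
      ≡⟨ ∑ₗ-++ H R (λ Z₁₂ → ∑ₗ (V ++ W) (λ Z₃₄ → F (Z₁₂ ++ Z₃₄))) ⟩
    ∑ (labellings H) (λ ℓ₁ → ∑ (labellings R) (λ ℓ₂ → ∑ₗ (V ++ W) (λ Z₃₄ → F ((zip H (toList ℓ₁) ++ zip R (toList ℓ₂)) ++ Z₃₄))))
      ≡⟨ ∑-cong (labellings H) (λ ℓ₁ → ∑-cong (labellings R) (λ ℓ₂ →
           trans (∑ₗ-++ V W (λ Z₃₄ → F ((zip H (toList ℓ₁) ++ zip R (toList ℓ₂)) ++ Z₃₄)))
                 (∑-cong (labellings V) (λ ℓ₃ → ∑-cong (labellings W) (λ ℓ₄ →
                   ColumnStep.magicWeight-split k (toList ℓ₁) (toList ℓ₂) (toList ℓ₃) (toList ℓ₄) ly))))) ⟩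
    ∑ (labellings H) (λ ℓ₁ → ∑ (labellings R) (λ ℓ₂ → ∑ (labellings V) (λ ℓ₃ → ∑ (labellings W) (λ ℓ₄ → Old ℓ₁ ℓ₂ ℓ₃ * New ℓ₂ ℓ₄))))
      ≡⟨ ∑-regroup (labellings H) (labellings R) (labellings V) (labellings W) Old New ⟩
    ∑ (labellings R) (λ ℓ₂ → ∑ (labellings H) (λ ℓ₁ → ∑ (labellings V) (Old ℓ₁ ℓ₂)) * ∑ (labellings W) (New ℓ₂))
      ≡⟨ ∑-cong (labellings R) (λ ℓ₂ → cong₂ _*_
           (sym (∑ₗ-++ H V (λ Z → magicWeight (Z ++ zip R (toList ℓ₂)) (vertices m (suc k)))))
           (∑-boundedVecs-cast (trans (length-verticals (suc k)) (sym (length-verticals 1)))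
             (λ l₄ → magicWeight (zip (rungs 0) (toList ℓ₂) ++ zip (verticals 1) l₄ ++ zip (rungs 1) ly) (column 1)))) ⟩
    ∑ (labellings R) (λ ℓ₂ → extendedCount k (toList ℓ₂) * transfer (toList ℓ₂) ly)
      ≡⟨ ∑-rungLabellings k (λ lz → extendedCount k lz * transfer lz ly) ⟩
    ∑ columnLabellings (λ lz → extendedCount k lz * transfer lz ly)
      ≡⟨ ∑-cong columnLabellings (λ lz → ℤ.*-comm (extendedCount k lz) (transfer lz ly)) ⟩
    ∑ columnLabellings (λ lz → transfer lz ly * extendedCount k lz) ∎
    where
    H = hEdges m (suc k)
    R = rungs k
    V = vEdges m (suc k)
    W = verticals (suc k)
    labellings : (es : List Edge) → List (Vec.Vec ℕ (length es))
    labellings es = boundedVecs (length es) t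
    F : Labelled → ℤ
    F Z = magicWeight (Z ++ zip (rungs (suc k)) ly) (vertices m (suc (suc k)))
    Old : Vec.Vec ℕ (length H) → Vec.Vec ℕ (length R) → Vec.Vec ℕ (length V) → ℤ
    Old ℓ₁ ℓ₂ ℓ₃ = magicWeight ((zip H (toList ℓ₁) ++ zip V (toList ℓ₃)) ++ zip R (toList ℓ₂)) (vertices m (suc k))
    New : Vec.Vec ℕ (length R) → Vec.Vec ℕ (length W) → ℤ
    New ℓ₂ ℓ₄ = magicWeight (zip (rungs 0) (toList ℓ₂) ++ zip (verticals 1) (toList ℓ₄) ++ zip (rungs 1) ly) (column 1)

  realization-T : LinearRealization (λ n → + T m (suc n) t)
  realization-T = record
    { State = List ℕ
    ; states = columnLabellings
    ; transition = λ ly lz → transfer lz ly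
    ; x = λ ly k → extendedCount k ly
    ; x-suc = λ ly k → extendedCount-suc k ly
    ; outputs = replicate m 0 ∷ []
    ; weight = λ _ → 1ℤ
    ; output = λ k → trans (T-extendedCount k) (sym (trans (ℤ.+-identityʳ _) (ℤ.*-identityˡ _)))
    }

pos-^ : ∀ a t → + (a ^ t) ≡ (+ a) ^ℤ t
pos-^ a zero    = refl
pos-^ a (suc t) = trans (ℤ.pos-* a (a ^ t)) (cong (+ a *_) (pos-^ a t))

theorem1p6 : (m t : ℕ) → 1 ≤ m → 1 ≤ t →
    SatisfiesLinearRecurrence (λ n → + T m n t)
    × SatisfiesLinearRecurrence (λ n → + (T m n 1 ^ t))
theorem1p6 m t _ _ =
  realization⇒recurrence (Tₜ t) ,
  realization⇒recurrence (realization-cong (λ n → sym (pos-^ (T m n 1) t)) (realization-^ (Tₜ 1) t))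
  where
  Tₜ : ∀ t → LinearRealization (λ n → + T m n t)
  Tₜ t = realization-pred (Grid.realization-T m t)
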